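{- For every constant $C$ there exist positive integers $n,k$ and a map $z:[n]\to[k]$ such that every simple-graph Markov basis for $A_{n,z}$ contains an element $\gamma$ with $\|\gamma\|_1>C$.
   Context: Coordinates of $\mathbb Z^{\binom n2}$ are indexed by 2-subsets $\{u,v\}$ of $[n]$. $D_n$ is the $n\times\binom n2$ vertex-edge incidence matrix of $K_n$; $C_z$ is the $\binom{k+1}2\times\binom n2$ matrix with rows indexed by pairs $(i,j)$, $1\le i\le j\le k$, whose column $\{u,v\}$ has a single $1$ in row $(\min(z(u),z(v)),\max(z(u),z(v)))$ and zeros elsewhere; $A_{n,z}$ is $D_n$ stacked on $C_z$. A vector $\gamma\in\{0,1\}^{\binom n2}$ is identified with the simple graph on $[n]$ with edge set $\{\{u,v\}:\gamma_{uv}=1\}$, and $A_{n,z}\gamma=(d;c)$ records its degree sequence $d$ and, for each color pair $i\le j$, the number $c(i,j)$ of edges joining a vertex of color $i$ with a vertex of color $j$. For a vector $(d;c)\in\mathbb N^{n+\binom{k+1}2}$ which equals $A_{n,z}\gamma$ for some $\gamma\in\{0,1\}^{\binom n2}$, the simple fiber is $\widetilde{\mathcal F}(d;c)=\{\gamma\in\{0,1\}^{\binom n2}:A_{n,z}\gamma=(d;c)\}$. A set $\mathcal B\subset\ker_{\mathbb Z}A_{n,z}$ is a simple-graph Markov basis for $A_{n,z}$ if for every such $(d;c)$ the graph on $\widetilde{\mathcal F}(d;c)$, with $\gamma,\gamma'$ adjacent iff $\gamma-\gamma'\in\mathcal B\cup(-\mathcal B)$, is connected. -}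

module Defs where

open import Data.Nat as ℕ using (ℕ)
open import Data.Integer as ℤ using (ℤ; +_; _-_; ∣_∣)
open import Data.Fin using (Fin; _<_; _≤_; _<?_; _≟_)
open import Data.Fin.Properties using () renaming (_≤?_ to _≤ᶠ?_)
open import Data.Bool using (Bool; true; false; if_then_else_)
open import Data.List using (List; []; _∷_; concatMap; map; foldr)
open import Data.List.Base using (allFin)
open import Data.Product using (Σ; Σ-syntax; ∃; ∃-syntax; _×_; _,_; proj₁; proj₂)
open import Data.Sum using (_⊎_)
open import Relation.Nullary using (yes; no)
open import Relation.Binary.PropositionalEquality using (_≡_)

-- A 2-subset {u,v} of [n], represented canonically as (u , v) with u < v.
Edge : ℕ → Set
Edge n = Σ[ p ∈ Fin n × Fin n ] proj₁ p < proj₂ p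

pairIfLess : {n : ℕ} → Fin n → Fin n → List (Edge n)
pairIfLess u v with u <? v
... | yes u<v = ((u , v) , u<v) ∷ []
... | no _    = []

edges : (n : ℕ) → List (Edge n)
edges n = concatMap (λ u → concatMap (λ v → pairIfLess u v) (allFin n)) (allFin n)

ZVec : ℕ → Set
ZVec n = Edge n → ℤ

Graph : ℕ → Set
Graph n = Edge n → Bool

b2z : Bool → ℤ
b2z true  = + 1
b2z false = + 0

asZ : {n : ℕ} → Graph n → ZVec n
asZ γ e = b2z (γ e)

Σe : {n : ℕ} → (Edge n → ℤ) → ℤ
Σe {n} f = foldr ℤ._+_ (+ 0) (map f (edges n))

-- Rows of D_n: entry (D_n x)_w = sum of x_e over edges e containing w.
incident : {n : ℕ} → Fin n → Edge n → Bool
incident w ((u , v) , _) with w ≟ u | w ≟ v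
... | yes _ | _     = true
... | no _  | yes _ = true
... | no _  | no _  = false

Dx : {n : ℕ} → ZVec n → Fin n → ℤ
Dx x w = Σe (λ e → if incident w e then x e else + 0)

-- Colour class of an edge under z : (min(z u, z v), max(z u, z v)) = (i , j), i ≤ j.
inColourClass : {n k : ℕ} → (Fin n → Fin k) → Fin k → Fin k → Edge n → Bool
inColourClass z i j ((u , v) , _) with z u ≤ᶠ? z v
... | yes _ with z u ≟ i | z v ≟ j
...   | yes _ | yes _ = true
...   | _     | _     = false
inColourClass z i j ((u , v) , _) | no _ with z v ≟ i | z u ≟ j
...   | yes _ | yes _ = true
...   | _     | _     = false

-- Rows of C_z: entry (C_z x)_(i,j) for i ≤ j.
Cx : {n k : ℕ} → (Fin n → Fin k) → ZVec n → Fin k → Fin k → ℤ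
Cx z x i j = Σe (λ e → if inColourClass z i j e then x e else + 0)

InKernel : {n k : ℕ} → (Fin n → Fin k) → ZVec n → Set
InKernel z x = (∀ w → Dx x w ≡ + 0) × (∀ i j → i ≤ j → Cx z x i j ≡ + 0)

SameImage : {n k : ℕ} → (Fin n → Fin k) → ZVec n → ZVec n → Set
SameImage z x y =
  (∀ w → Dx x w ≡ Dx y w) × (∀ i j → i ≤ j → Cx z x i j ≡ Cx z y i j)

VSet : ℕ → Set₁
VSet n = ZVec n → Set

Adjacent : {n : ℕ} → VSet n → Graph n → Graph n → Set
Adjacent B γ γ' = ∃[ b ] B b ×
  ((∀ e → b e ≡ asZ γ e - asZ γ' e) ⊎ (∀ e → b e ≡ asZ γ' e - asZ γ e))

data Walk {n k : ℕ} (z : Fin n → Fin k) (B : VSet n) (γ₀ : Graph n)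
     : Graph n → Graph n → Set where
  here : ∀ {γ} → SameImage z (asZ γ) (asZ γ₀) → Walk z B γ₀ γ γ
  step : ∀ {γ γ' γ''} → SameImage z (asZ γ) (asZ γ₀) → Adjacent B γ γ'
       → Walk z B γ₀ γ' γ'' → Walk z B γ₀ γ γ''

IsSimpleMarkovBasis : {n k : ℕ} → (Fin n → Fin k) → VSet n → Set
IsSimpleMarkovBasis z B =
  (∀ b → B b → InKernel z b) ×
  (∀ (γ₀ γ γ' : Graph _) →
     SameImage z (asZ γ) (asZ γ₀) → SameImage z (asZ γ') (asZ γ₀) →
     Walk z B γ₀ γ γ')

norm1 : {n : ℕ} → ZVec n → ℕ
norm1 {n} x = foldr ℕ._+_ 0 (map (λ e → ∣ x e ∣) (edges n))

{-# OPTIONS --safe #-}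
-- Take m = C + 3 colours and 2m vertices hi a, lo a of colour a, and let ρ = rotate be the cyclic
-- shift of the colours (m ≥ 3 makes ρ² fixed-point free).  The graph γ is the clique on the hi
-- vertices plus the perfect matching hi a – lo (ρ a); the graph γ′ replaces it by the reverse matching
-- hi (ρ b) – lo b, and has the same degrees and colour counts.  Let γ₁ be any graph in this fibre and
-- δ = γ₁ − γ.  Since γ has all hi–hi and no lo–lo edges, weighting the degree equations of δ by −1 on hi
-- and +1 on lo vertices gives a sum of nonnegative terms, so δ lives on the hi–lo edges.  There δ is
-- ≤ 0 on the matching and ≥ 0 elsewhere, and the colour class {a, ρ a} together with the degree of
-- hi (ρ a) show that δ vanishes on the matching edge at a iff it does at ρ a.  Around the cycle, either
-- δ = 0 or all m matching entries of δ are nonzero.  So γ is at ℓ¹-distance ≥ m from every other point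
-- of its fibre, and a walk from γ to γ′ has to leave γ through such a basis move.

module Submission where

open import Defs
open import Data.Nat using (ℕ; _<_; _≤_)
open import Data.Fin using (Fin)
open import Data.Product using (Σ-syntax; ∃-syntax; _×_)

import Data.Integer.Properties as ZP
open import Algebra.Properties.CommutativeMonoid.Sum ZP.+-0-commutativeMonoid
  using (sum; sum-syntax; sum-cong-≗; ∑-distrib-+; ∑-comm; sum-replicate-zero; sum-init-last)
open import Algebra.Properties.CommutativeSemigroup ZP.+-commutativeSemigroup using (interchange)
open import Data.Bool using (Bool; true; false; if_then_else_; _∨_)
import Data.Bool.Properties as Bool
open import Data.Empty using (⊥-elim)
open import Data.Fin as Fin using (zero; suc; _↑ˡ_; _↑ʳ_; splitAt; inject₁; fromℕ; toℕ)
open import Data.Fin.Induction using (<-weakInduction)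
open import Data.Fin.Properties
  using (_≟_; <-irrelevant; <-asym; <-irrefl; ≤-antisym; ≤-total; toℕ<n; toℕ-↑ˡ; toℕ-↑ʳ; ↑ˡ-injective; ↑ʳ-injective;
         splitAt-↑ˡ; splitAt-↑ʳ; splitAt⁻¹-↑ˡ; splitAt⁻¹-↑ʳ; fromℕ≢inject₁; inject₁-injective; toℕ-inject₁)
  renaming (_≤?_ to _≤ᶠ?_)
open import Data.Integer using (ℤ; +_; 0ℤ; 1ℤ; -1ℤ; -_; _+_; _-_; _*_; +≤+; -≤+; ∣_∣) renaming (_≤_ to _≤ℤ_)
open import Data.List using (List; []; _∷_; _++_; map; foldr; concatMap; tabulate; allFin)
open import Data.List.Membership.Propositional using (_∈_; lose)
open import Data.List.Membership.Propositional.Properties using (∈-concatMap⁺; ∈-allFin)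
open import Data.List.Properties using (map-cong)
open import Data.List.Relation.Unary.All as All using (all?)
open import Data.List.Relation.Unary.Any using (here; there)
open import Data.Nat as ℕ using (z≤n)
import Data.Nat.Properties as NP
open import Data.Product using (_,_; proj₁; proj₂; map₂)
open import Data.Sum using (_⊎_; inj₁; inj₂; reduce; [_,_]′)
open import Function using (id; _∘_; _⇔_; mk⇔; Equivalence)
import Function.Properties.Equivalence as ⇔
open import Relation.Binary.PropositionalEquality
open import Relation.Nullary using (¬_; Dec; does; yes; no)
open import Relation.Nullary.Decidable using (map′; dec-true; dec-false; does-≡)

+-nonneg : ∀ {i j} → 0ℤ ≤ℤ i → 0ℤ ≤ℤ j → 0ℤ ≤ℤ i + j
+-nonneg (+≤+ _) (+≤+ _) = +≤+ z≤n

+-nonneg≡0 : ∀ {i j} → 0ℤ ≤ℤ i → 0ℤ ≤ℤ j → i + j ≡ 0ℤ → i ≡ 0ℤ × j ≡ 0ℤ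
+-nonneg≡0 {+ a} {+ b} _ _ a+b≡0 = cong +_ (NP.m+n≡0⇒m≡0 a eq) , cong +_ (NP.m+n≡0⇒n≡0 a eq)
  where eq = ZP.+-injective a+b≡0

if-− : ∀ b i j → (if b then i - j else 0ℤ) ≡ (if b then i else 0ℤ) - (if b then j else 0ℤ)
if-− true  i j = refl
if-− false i j = refl

does≡true⇒ : ∀ {A : Set} (a? : Dec A) → does a? ≡ true → A
does≡true⇒ (yes a) _ = a

b2z-if : ∀ d → b2z d ≡ (if d then + 1 else 0ℤ)
b2z-if true  = refl
b2z-if false = refl

b2z-injective : ∀ {c d} → b2z c ≡ b2z d → c ≡ d
b2z-injective {true}  {true}  _ = refl
b2z-injective {false} {false} _ = refl

if-b2z-comm : ∀ c d → (if c then b2z d else 0ℤ) ≡ (if d then b2z c else 0ℤ)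
if-b2z-comm true  true  = refl
if-b2z-comm true  false = refl
if-b2z-comm false true  = refl
if-b2z-comm false false = refl

module _ {A : Set} where

  ΣL : List A → (A → ℤ) → ℤ
  ΣL xs f = foldr _+_ 0ℤ (map f xs)

  ΣL-cong : ∀ xs {f g : A → ℤ} → f ≗ g → ΣL xs f ≡ ΣL xs g
  ΣL-cong xs f≗g = cong (foldr _+_ 0ℤ) (map-cong f≗g xs)

  ΣL-++ : ∀ xs ys (f : A → ℤ) → ΣL (xs ++ ys) f ≡ ΣL xs f + ΣL ys f
  ΣL-++ []       ys f = sym (ZP.+-identityˡ _)
  ΣL-++ (x ∷ xs) ys f = trans (cong (_+_ (f x)) (ΣL-++ xs ys f)) (sym (ZP.+-assoc (f x) _ _))

  ΣL-neg : ∀ xs (f : A → ℤ) → ΣL xs (λ x → - f x) ≡ - ΣL xs f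
  ΣL-neg []       f = refl
  ΣL-neg (x ∷ xs) f = trans (cong (_+_ (- f x)) (ΣL-neg xs f)) (sym (ZP.neg-distrib-+ (f x) _))

  ΣL-distrib-+ : ∀ xs (f g : A → ℤ) → ΣL xs (λ x → f x + g x) ≡ ΣL xs f + ΣL xs g
  ΣL-distrib-+ []       f g = refl
  ΣL-distrib-+ (x ∷ xs) f g = trans (cong (_+_ (f x + g x)) (ΣL-distrib-+ xs f g)) (interchange (f x) (g x) _ _)

  ΣL-distrib-− : ∀ xs (f g : A → ℤ) → ΣL xs (λ x → f x - g x) ≡ ΣL xs f - ΣL xs g
  ΣL-distrib-− xs f g = trans (ΣL-distrib-+ xs f (λ x → - g x)) (cong (_+_ (ΣL xs f)) (ΣL-neg xs g))

  *-distribˡ-ΣL : ∀ c xs (f : A → ℤ) → c * ΣL xs f ≡ ΣL xs (λ x → c * f x)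
  *-distribˡ-ΣL c []       f = ZP.*-zeroʳ c
  *-distribˡ-ΣL c (x ∷ xs) f = trans (ZP.*-distribˡ-+ c (f x) _) (cong (_+_ (c * f x)) (*-distribˡ-ΣL c xs f))

  ΣL-nonneg : ∀ xs {f : A → ℤ} → (∀ x → 0ℤ ≤ℤ f x) → 0ℤ ≤ℤ ΣL xs f
  ΣL-nonneg []       _  = ZP.≤-refl
  ΣL-nonneg (x ∷ xs) f≥0 = +-nonneg (f≥0 x) (ΣL-nonneg xs f≥0)

  ΣL≡0⇒nonneg-terms≡0 : ∀ xs {f : A → ℤ} → (∀ x → 0ℤ ≤ℤ f x) → ΣL xs f ≡ 0ℤ →
                        ∀ {x} → x ∈ xs → f x ≡ 0ℤ
  ΣL≡0⇒nonneg-terms≡0 (y ∷ xs) f≥0 sum≡0 (here refl) = proj₁ (+-nonneg≡0 (f≥0 y) (ΣL-nonneg xs f≥0) sum≡0)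
  ΣL≡0⇒nonneg-terms≡0 (y ∷ xs) f≥0 sum≡0 (there x∈xs) =
    ΣL≡0⇒nonneg-terms≡0 xs f≥0 (proj₂ (+-nonneg≡0 (f≥0 y) (ΣL-nonneg xs f≥0) sum≡0)) x∈xs

  ΣL-tabulate : ∀ {n} (g : Fin n → A) (f : A → ℤ) → ΣL (tabulate g) f ≡ ∑[ i < n ] f (g i)
  ΣL-tabulate {ℕ.zero}  g f = refl
  ΣL-tabulate {ℕ.suc n} g f = cong (_+_ (f (g zero))) (ΣL-tabulate (g ∘ suc) f)

  ∑-ΣL-comm : ∀ {n} xs (F : Fin n → A → ℤ) → ∑[ i < n ] ΣL xs (F i) ≡ ΣL xs (λ x → ∑[ i < n ] F i x)
  ∑-ΣL-comm {n} []       F = sum-replicate-zero n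
  ∑-ΣL-comm     (x ∷ xs) F =
    trans (∑-distrib-+ (λ i → F i x) _) (cong (_+_ (∑[ i < _ ] F i x)) (∑-ΣL-comm xs F))

ΣL-concatMap : ∀ {A B : Set} (g : B → List A) xs (f : A → ℤ) → ΣL (concatMap g xs) f ≡ ΣL xs (λ x → ΣL (g x) f)
ΣL-concatMap g []       f = refl
ΣL-concatMap g (x ∷ xs) f = trans (ΣL-++ (g x) _ f) (cong (_+_ (ΣL (g x) f)) (ΣL-concatMap g xs f))

ΣL-allFin : ∀ {n} (f : Fin n → ℤ) → ΣL (allFin n) f ≡ ∑[ i < n ] f i
ΣL-allFin = ΣL-tabulate id

∑-neg : ∀ {n} (f : Fin n → ℤ) → ∑[ i < n ] (- f i) ≡ - ∑[ i < n ] f i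
∑-neg {ℕ.zero}  f = refl
∑-neg {ℕ.suc n} f = trans (cong (_+_ (- f zero)) (∑-neg (f ∘ suc))) (sym (ZP.neg-distrib-+ (f zero) _))

∑-distrib-− : ∀ {n} (f g : Fin n → ℤ) → ∑[ i < n ] (f i - g i) ≡ ∑[ i < n ] f i - ∑[ i < n ] g i
∑-distrib-− f g = trans (∑-distrib-+ f (λ i → - g i)) (cong (_+_ (∑[ i < _ ] f i)) (∑-neg g))

∑-mono-≤ : ∀ {n} {f g : Fin n → ℤ} → (∀ i → f i ≤ℤ g i) → ∑[ i < n ] f i ≤ℤ ∑[ i < n ] g i
∑-mono-≤ {ℕ.zero}  f≤g = ZP.≤-refl
∑-mono-≤ {ℕ.suc n} f≤g = ZP.+-mono-≤ (f≤g zero) (∑-mono-≤ (f≤g ∘ suc))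

∑-one : ∀ n → ∑[ i < n ] (+ 1) ≡ + n
∑-one ℕ.zero    = refl
∑-one (ℕ.suc n) = cong (_+_ (+ 1)) (∑-one n)

∑-if : ∀ {n} (c : Bool) (f : Fin n → ℤ) → ∑[ i < n ] (if c then f i else 0ℤ) ≡ (if c then ∑[ i < n ] f i else 0ℤ)
∑-if     true  f = refl
∑-if {n} false f = sum-replicate-zero n

∑-selectˡ : ∀ {n} (u : Fin n) (G : Fin n → ℤ) → ∑[ w < n ] (if does (u ≟ w) then G w else 0ℤ) ≡ G u
∑-selectˡ {ℕ.suc n} zero    G = trans (cong (_+_ (G zero)) (sum-replicate-zero n)) (ZP.+-identityʳ _)
∑-selectˡ           (suc u) G = trans (ZP.+-identityˡ _) (∑-selectˡ u (G ∘ suc))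

∑-selectʳ : ∀ {n} (u : Fin n) (G : Fin n → ℤ) → ∑[ w < n ] (if does (w ≟ u) then G w else 0ℤ) ≡ G u
∑-selectʳ {ℕ.suc n} zero    G = trans (cong (_+_ (G zero)) (sum-replicate-zero n)) (ZP.+-identityʳ _)
∑-selectʳ           (suc u) G = trans (ZP.+-identityˡ _) (∑-selectʳ u (G ∘ suc))

∑-indicatorˡ : ∀ {n} (u : Fin n) → ∑[ w < n ] b2z (does (u ≟ w)) ≡ + 1
∑-indicatorˡ u = trans (sum-cong-≗ (λ w → b2z-if (does (u ≟ w)))) (∑-selectˡ u (λ _ → + 1))

∑-indicatorʳ : ∀ {n} (u : Fin n) → ∑[ w < n ] b2z (does (w ≟ u)) ≡ + 1
∑-indicatorʳ u = trans (sum-cong-≗ (λ w → b2z-if (does (w ≟ u)))) (∑-selectʳ u (λ _ → + 1))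

term≤∑ : ∀ {n} {f : Fin n → ℤ} → (∀ i → 0ℤ ≤ℤ f i) → ∀ u → f u ≤ℤ ∑[ i < n ] f i
term≤∑ {f = f} f≥0 u = subst (_≤ℤ ∑[ i < _ ] f i) (∑-selectʳ u f) (∑-mono-≤ term≤)
  where
  term≤ : ∀ i → (if does (i ≟ u) then f i else 0ℤ) ≤ℤ f i
  term≤ i with does (i ≟ u)
  ... | true  = ZP.≤-refl
  ... | false = f≥0 i

∑-splitAt : ∀ m {m′} (f : Fin (m ℕ.+ m′) → ℤ) →
            ∑[ i < m ℕ.+ m′ ] f i ≡ ∑[ a < m ] f (a ↑ˡ m′) + ∑[ b < m′ ] f (m ↑ʳ b)
∑-splitAt ℕ.zero    f = sym (ZP.+-identityˡ _)
∑-splitAt (ℕ.suc m) f = trans (cong (_+_ (f zero)) (∑-splitAt m (f ∘ suc))) (sym (ZP.+-assoc (f zero) _ _))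

module _ {n : ℕ} where

  ∈-pairIfLess : ∀ {u v : Fin n} (u<v : u Fin.< v) → ((u , v) , u<v) ∈ pairIfLess u v
  ∈-pairIfLess {u} {v} u<v with u Fin.<? v
  ... | yes p  = here (cong ((u , v) ,_) (<-irrelevant u<v p))
  ... | no u≮v = ⊥-elim (u≮v u<v)

  ∈-edges : (e : Edge n) → e ∈ edges n
  ∈-edges ((u , v) , u<v) =
    ∈-concatMap⁺ _ (lose (∈-allFin u) (∈-concatMap⁺ _ (lose (∈-allFin v) (∈-pairIfLess u<v))))

  Σe-pairs : (f : Edge n → ℤ) → Σe f ≡ ∑[ u < n ] ∑[ v < n ] ΣL (pairIfLess u v) f
  Σe-pairs f = begin
    Σe f
      ≡⟨ ΣL-concatMap _ (allFin n) f ⟩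
    ΣL (allFin n) (λ u → ΣL (concatMap (pairIfLess u) (allFin n)) f)
      ≡⟨ ΣL-cong (allFin n) (λ u → trans (ΣL-concatMap (pairIfLess u) (allFin n) f) (ΣL-allFin (λ v → ΣL (pairIfLess u v) f))) ⟩
    ΣL (allFin n) (λ u → ∑[ v < n ] ΣL (pairIfLess u v) f)
      ≡⟨ ΣL-allFin (λ u → ∑[ v < n ] ΣL (pairIfLess u v) f) ⟩
    ∑[ u < n ] ∑[ v < n ] ΣL (pairIfLess u v) f
      ∎
    where open ≡-Reasoning

  ΣL-pairIfLess-< : ∀ {u v : Fin n} (u<v : u Fin.< v) (f : Edge n → ℤ) → ΣL (pairIfLess u v) f ≡ f ((u , v) , u<v)
  ΣL-pairIfLess-< {u} {v} u<v f with u Fin.<? v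
  ... | yes p  = trans (ZP.+-identityʳ _) (cong (λ q → f ((u , v) , q)) (<-irrelevant p u<v))
  ... | no u≮v = ⊥-elim (u≮v u<v)

  ΣL-pairIfLess-0 : ∀ {u v : Fin n} (f : Edge n → ℤ) → (∀ u<v → f ((u , v) , u<v) ≡ 0ℤ) → ΣL (pairIfLess u v) f ≡ 0ℤ
  ΣL-pairIfLess-0 {u} {v} f f≡0 with u Fin.<? v
  ... | yes p = trans (ZP.+-identityʳ _) (f≡0 p)
  ... | no _  = refl

  row : (Edge n → Bool) → ZVec n → ℤ
  row r x = Σe (λ e → if r e then x e else 0ℤ)

  row-− : ∀ r (x y : ZVec n) → row r (λ e → x e - y e) ≡ row r x - row r y
  row-− r x y = trans (ΣL-cong (edges n) (λ e → if-− (r e) (x e) (y e))) (ΣL-distrib-− (edges n) _ _)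

  row-neg : ∀ r (x : ZVec n) → row r (λ e → - x e) ≡ - row r x
  row-neg r x = trans (ΣL-cong (edges n) (λ e → if-neg (r e) (x e))) (ΣL-neg (edges n) _)
    where
    if-neg : ∀ b i → (if b then - i else 0ℤ) ≡ - (if b then i else 0ℤ)
    if-neg true  i = refl
    if-neg false i = refl

  row≡0⇒nonneg-entries≡0 : ∀ r (x : ZVec n) → (∀ e → r e ≡ true → 0ℤ ≤ℤ x e) → row r x ≡ 0ℤ →
                 ∀ e → r e ≡ true → x e ≡ 0ℤ
  row≡0⇒nonneg-entries≡0 r x x≥0 row≡0 e re =
    subst (λ b → (if b then x e else 0ℤ) ≡ 0ℤ) re (ΣL≡0⇒nonneg-terms≡0 (edges n) terms≥0 row≡0 (∈-edges e))
    where
    terms≥0 : ∀ e → 0ℤ ≤ℤ (if r e then x e else 0ℤ)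
    terms≥0 e with r e in re
    ... | true  = x≥0 e re
    ... | false = ZP.≤-refl

  row≡0⇒nonpos-entries≡0 : ∀ r (x : ZVec n) → (∀ e → r e ≡ true → x e ≤ℤ 0ℤ) → row r x ≡ 0ℤ →
                 ∀ e → r e ≡ true → x e ≡ 0ℤ
  row≡0⇒nonpos-entries≡0 r x x≤0 row≡0 e re = begin
    x e     ≡⟨ ZP.neg-involutive (x e) ⟨
    - - x e ≡⟨ cong -_ (row≡0⇒nonneg-entries≡0 r (λ e → - x e) (λ e → ZP.neg-mono-≤ ∘ x≤0 e) -row≡0 e re) ⟩
    0ℤ      ∎
    where
    open ≡-Reasoning
    -row≡0 : row r (λ e → - x e) ≡ 0ℤ
    -row≡0 = trans (row-neg r x) (cong -_ row≡0)

  incident-∨ : ∀ (w u v : Fin n) (u<v : u Fin.< v) → incident w ((u , v) , u<v) ≡ does (w ≟ u) ∨ does (w ≟ v)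
  incident-∨ w u v _ with w ≟ u | w ≟ v
  ... | yes _ | _     = refl
  ... | no _  | yes _ = refl
  ... | no _  | no _  = refl

  weight : (Fin n → ℤ) → Edge n → ℤ
  weight s ((u , v) , _) = s u + s v

  ∑-weighted-degree : (s : Fin n → ℤ) (x : ZVec n) → ∑[ w < n ] (s w * Dx x w) ≡ Σe (λ e → weight s e * x e)
  ∑-weighted-degree s x = begin
    ∑[ w < n ] (s w * Dx x w)
      ≡⟨ sum-cong-≗ (λ w → *-distribˡ-ΣL (s w) (edges n) _) ⟩
    ∑[ w < n ] ΣL (edges n) (λ e → s w * (if incident w e then x e else 0ℤ))
      ≡⟨ ∑-ΣL-comm (edges n) (λ w e → s w * (if incident w e then x e else 0ℤ)) ⟩
    ΣL (edges n) (λ e → ∑[ w < n ] (s w * (if incident w e then x e else 0ℤ)))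
      ≡⟨ ΣL-cong (edges n) incidence ⟩
    Σe (λ e → weight s e * x e)
      ∎
    where
    open ≡-Reasoning
    split : ∀ e w → s w * (if incident w e then x e else 0ℤ) ≡
      (if does (w ≟ proj₁ (proj₁ e)) then s w * x e else 0ℤ) + (if does (w ≟ proj₂ (proj₁ e)) then s w * x e else 0ℤ)
    split ((u , v) , u<v) w with w ≟ u | w ≟ v
    ... | yes refl | yes refl = ⊥-elim (NP.<-irrefl refl u<v)
    ... | yes _    | no _     = sym (ZP.+-identityʳ _)
    ... | no _     | yes _    = sym (ZP.+-identityˡ _)
    ... | no _     | no _     = ZP.*-zeroʳ (s w)
    incidence : ∀ e → ∑[ w < n ] (s w * (if incident w e then x e else 0ℤ)) ≡ weight s e * x e
    incidence e@((u , v) , _) = begin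
      ∑[ w < n ] (s w * (if incident w e then x e else 0ℤ))
        ≡⟨ trans (sum-cong-≗ (split e)) (∑-distrib-+ (λ w → if does (w ≟ u) then s w * x e else 0ℤ) _) ⟩
      ∑[ w < n ] (if does (w ≟ u) then s w * x e else 0ℤ) + ∑[ w < n ] (if does (w ≟ v) then s w * x e else 0ℤ)
        ≡⟨ cong₂ _+_ (∑-selectʳ u (λ w → s w * x e)) (∑-selectʳ v (λ w → s w * x e)) ⟩
      s u * x e + s v * x e
        ≡⟨ ZP.*-distribʳ-+ (x e) (s u) (s v) ⟨
      weight s e * x e
        ∎

  _≗?_ : (γ γ′ : Graph n) → Dec (γ ≗ γ′)
  γ ≗? γ′ = map′ (λ all e → All.lookup all (∈-edges e)) (λ γ≗γ′ → All.tabulate (λ {e} _ → γ≗γ′ e))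
                 (all? (λ e → γ e Bool.≟ γ′ e) (edges n))

  norm1-cong : ∀ {x y : ZVec n} → (∀ e → ∣ x e ∣ ≡ ∣ y e ∣) → norm1 x ≡ norm1 y
  norm1-cong ∣x∣≡∣y∣ = cong (foldr ℕ._+_ 0) (map-cong ∣x∣≡∣y∣ (edges n))

  norm1-as-Σe : ∀ (x : ZVec n) → + norm1 x ≡ Σe (λ e → + ∣ x e ∣)
  norm1-as-Σe x = go (edges n)
    where
    go : ∀ es → + foldr ℕ._+_ 0 (map (λ e → ∣ x e ∣) es) ≡ ΣL es (λ e → + ∣ x e ∣)
    go []       = refl
    go (e ∷ es) = cong (_+_ (+ ∣ x e ∣)) (go es)

  _⊖_ : Graph n → Graph n → ZVec n
  (γ ⊖ γ′) e = asZ γ e - asZ γ′ e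

module _ {n k : ℕ} (z : Fin n → Fin k) where

  SameImage⇒InKernel : ∀ {x y} → SameImage z x y → InKernel z (λ e → x e - y e)
  SameImage⇒InKernel {x} {y} (Dx≡ , Cx≡) =
    (λ w → trans (row-− (incident w) x y) (ZP.i≡j⇒i-j≡0 (Dx≡ w))) ,
    (λ i j i≤j → trans (row-− (inColourClass z i j) x y) (ZP.i≡j⇒i-j≡0 (Cx≡ i j i≤j)))

  InKernel⇒SameImage : ∀ {x y} → InKernel z (λ e → x e - y e) → SameImage z x y
  InKernel⇒SameImage {x} {y} (D≡0 , C≡0) =
    (λ w → ZP.i-j≡0⇒i≡j _ _ (trans (sym (row-− (incident w) x y)) (D≡0 w))) ,
    (λ i j i≤j → ZP.i-j≡0⇒i≡j _ _ (trans (sym (row-− (inColourClass z i j) x y)) (C≡0 i j i≤j)))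

module _ {n k : ℕ} {z : Fin n → Fin k} {B : VSet n} {γ₀ : Graph n} {L : ℕ}
         (far : ∀ (γ : Graph n) → SameImage z (asZ γ) (asZ γ₀) → ¬ γ ≗ γ₀ → L ≤ norm1 (γ ⊖ γ₀)) where

  walk-start : ∀ {γ γ′} → Walk z B γ₀ γ γ′ → SameImage z (asZ γ) (asZ γ₀)
  walk-start (here fib)     = fib
  walk-start (step fib _ _) = fib

  walk-leaving⇒long-move : ∀ {γ γ′} → Walk z B γ₀ γ γ′ → γ ≗ γ₀ → ¬ γ′ ≗ γ₀ → ∃[ b ] B b × L ≤ norm1 b
  walk-leaving⇒long-move (here _) γ≗γ₀ γ′≉γ₀ = ⊥-elim (γ′≉γ₀ γ≗γ₀)
  walk-leaving⇒long-move {γ} (step {γ' = γ₁} _ (b , b∈B , b≡±) walk) γ≗γ₀ γ′≉γ₀ with γ₁ ≗? γ₀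
  ... | yes γ₁≗γ₀ = walk-leaving⇒long-move walk γ₁≗γ₀ γ′≉γ₀
  ... | no  γ₁≉γ₀ =
    b , b∈B , subst (L ≤_) (norm1-cong {x = γ₁ ⊖ γ₀} {y = b} (∣b∣≡ b≡±)) (far γ₁ (walk-start walk) γ₁≉γ₀)
    where
    ∣b∣≡ : (b ≗ γ ⊖ γ₁) ⊎ (b ≗ γ₁ ⊖ γ) → ∀ e → ∣ (γ₁ ⊖ γ₀) e ∣ ≡ ∣ b e ∣
    ∣b∣≡ (inj₁ b≗) e = trans (ZP.∣i-j∣≡∣j-i∣ (asZ γ₁ e) _)
                             (cong ∣_∣ (trans (cong (λ c → b2z c - asZ γ₁ e) (sym (γ≗γ₀ e))) (sym (b≗ e))))
    ∣b∣≡ (inj₂ b≗) e = cong ∣_∣ (trans (cong (λ c → asZ γ₁ e - b2z c) (sym (γ≗γ₀ e))) (sym (b≗ e)))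

  far-fibre-point⇒long-move : IsSimpleMarkovBasis z B → ∀ γ → SameImage z (asZ γ) (asZ γ₀) → ¬ γ ≗ γ₀ →
                              ∃[ b ] B b × L ≤ norm1 b
  far-fibre-point⇒long-move (_ , connected) γ fib γ≉γ₀ =
    walk-leaving⇒long-move (connected γ₀ γ₀ γ ((λ _ → refl) , (λ _ _ _ → refl)) fib) (λ _ → refl) γ≉γ₀

module _ {A : Set} where

  _≈ᵘ_ : A × A → A × A → Set
  (a , b) ≈ᵘ (c , d) = (a ≡ c × b ≡ d) ⊎ (a ≡ d × b ≡ c)

  ≈ᵘ-sym : ∀ {p q} → p ≈ᵘ q → q ≈ᵘ p
  ≈ᵘ-sym (inj₁ (refl , refl)) = inj₁ (refl , refl)
  ≈ᵘ-sym (inj₂ (refl , refl)) = inj₂ (refl , refl)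

  ≈ᵘ-swap : ∀ {a b r} → (a , b) ≈ᵘ r → (b , a) ≈ᵘ r
  ≈ᵘ-swap (inj₁ (refl , refl)) = inj₂ (refl , refl)
  ≈ᵘ-swap (inj₂ (refl , refl)) = inj₁ (refl , refl)

  ≈ᵘ-trans : ∀ {p q r} → p ≈ᵘ q → q ≈ᵘ r → p ≈ᵘ r
  ≈ᵘ-trans (inj₁ (refl , refl)) q≈r = q≈r
  ≈ᵘ-trans (inj₂ (refl , refl)) q≈r = ≈ᵘ-swap q≈r

sortPair : ∀ {k} (a b : Fin k) → ∃[ i ] ∃[ j ] i Fin.≤ j × (a , b) ≈ᵘ (i , j)
sortPair a b with ≤-total a b
... | inj₁ a≤b = a , b , a≤b , inj₁ (refl , refl)
... | inj₂ b≤a = b , a , b≤a , inj₂ (refl , refl)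

module _ {k : ℕ} {i j : Fin k} (i≤j : i Fin.≤ j) {a b : Fin k} where

  ≈ᵘ-sorted-≤ : a Fin.≤ b → (a , b) ≈ᵘ (i , j) → a ≡ i × b ≡ j
  ≈ᵘ-sorted-≤ _   (inj₁ eqs) = eqs
  ≈ᵘ-sorted-≤ a≤b (inj₂ (refl , refl)) with refl ← ≤-antisym i≤j a≤b = refl , refl

  ≈ᵘ-sorted-≰ : ¬ a Fin.≤ b → (a , b) ≈ᵘ (i , j) → b ≡ i × a ≡ j
  ≈ᵘ-sorted-≰ a≰b (inj₁ (refl , refl)) = ⊥-elim (a≰b i≤j)
  ≈ᵘ-sorted-≰ _   (inj₂ (a≡j , b≡i))   = b≡i , a≡j

module _ {n k : ℕ} (z : Fin n → Fin k) {i j : Fin k} where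

  inColourClass⇒ : ∀ {u v} (u<v : u Fin.< v) → inColourClass z i j ((u , v) , u<v) ≡ true →
                   (z u , z v) ≈ᵘ (i , j)
  inColourClass⇒ {u} {v} _ with z u ≤ᶠ? z v
  ... | yes _ with z u ≟ i | z v ≟ j
  ...   | yes zu≡i | yes zv≡j = λ _ → inj₁ (zu≡i , zv≡j)
  ...   | yes _    | no _     = λ ()
  ...   | no _     | _        = λ ()
  inColourClass⇒ {u} {v} _ | no _ with z v ≟ i | z u ≟ j
  ...   | yes zv≡i | yes zu≡j = λ _ → inj₂ (zu≡j , zv≡i)
  ...   | yes _    | no _     = λ ()
  ...   | no _     | _        = λ ()

  inColourClass⇐ : i Fin.≤ j → ∀ {u v} (u<v : u Fin.< v) → (z u , z v) ≈ᵘ (i , j) →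
                   inColourClass z i j ((u , v) , u<v) ≡ true
  inColourClass⇐ i≤j {u} {v} _ zuv≈ij with z u ≤ᶠ? z v
  ... | yes zu≤zv with z u ≟ i | z v ≟ j | ≈ᵘ-sorted-≤ i≤j zu≤zv zuv≈ij
  ...   | yes _    | yes _    | _ = refl
  ...   | no zu≢i  | _        | (zu≡i , _) = ⊥-elim (zu≢i zu≡i)
  ...   | yes _    | no zv≢j  | (_ , zv≡j) = ⊥-elim (zv≢j zv≡j)
  inColourClass⇐ i≤j {u} {v} _ zuv≈ij | no zu≰zv with z v ≟ i | z u ≟ j | ≈ᵘ-sorted-≰ i≤j zu≰zv zuv≈ij
  ...   | yes _    | yes _    | _ = refl
  ...   | no zv≢i  | _        | (zv≡i , _) = ⊥-elim (zv≢i zv≡i)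
  ...   | yes _    | no zu≢j  | (_ , zu≡j) = ⊥-elim (zu≢j zu≡j)

module _ {K : ℕ} where

  rotate : Fin (ℕ.suc K) → Fin (ℕ.suc K)
  rotate zero    = fromℕ K
  rotate (suc j) = inject₁ j

  rotate-injective : ∀ {a b} → rotate a ≡ rotate b → a ≡ b
  rotate-injective {zero}  {zero}  _  = refl
  rotate-injective {zero}  {suc j} eq = ⊥-elim (fromℕ≢inject₁ eq)
  rotate-injective {suc i} {zero}  eq = ⊥-elim (fromℕ≢inject₁ (sym eq))
  rotate-injective {suc i} {suc j} eq = cong suc (inject₁-injective eq)

  ∑-rotate : (f : Fin (ℕ.suc K) → ℤ) → ∑[ a < ℕ.suc K ] f (rotate a) ≡ ∑[ a < ℕ.suc K ] f a
  ∑-rotate f = trans (ZP.+-comm (f (fromℕ K)) _) (sym (sum-init-last f))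

  rotate-invariant⇒constant : (P : Fin (ℕ.suc K) → Set) → (∀ a → P a ⇔ P (rotate a)) → ∀ a b → P a → P b
  rotate-invariant⇒constant P invariant a b Pa = Equivalence.from (P⇔P₀ b) (Equivalence.to (P⇔P₀ a) Pa)
    where
    P⇔P₀ : ∀ a → P a ⇔ P zero
    P⇔P₀ = <-weakInduction (λ a → P a ⇔ P zero) ⇔.refl (λ j → ⇔.trans (invariant (suc j)))

rotate²≢id : ∀ {K} (a : Fin (3 ℕ.+ K)) → rotate (rotate a) ≢ a
rotate²≢id zero ()
rotate²≢id (suc zero) ()
rotate²≢id (suc (suc j)) eq = NP.m≢1+n+m (toℕ j) {1} (begin
  toℕ j                         ≡⟨ toℕ-inject₁ j ⟨
  toℕ (inject₁ j)               ≡⟨ toℕ-inject₁ (inject₁ j) ⟨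
  toℕ (inject₁ (inject₁ j))     ≡⟨ cong toℕ eq ⟩
  toℕ (suc (suc j))             ∎)
  where open ≡-Reasoning

module Construction (K : ℕ) where

  m : ℕ
  m = 3 ℕ.+ K

  n : ℕ
  n = m ℕ.+ m

  hi lo : Fin m → Fin n
  hi a = a ↑ˡ m
  lo b = m ↑ʳ b

  colour : Fin n → Fin m
  colour = reduce ∘ splitAt m

  colour-hi : ∀ a → colour (hi a) ≡ a
  colour-hi a = cong reduce (splitAt-↑ˡ m a m)

  colour-lo : ∀ b → colour (lo b) ≡ b
  colour-lo b = cong reduce (splitAt-↑ʳ m m b)

  hi<lo : ∀ a b → hi a Fin.< lo b
  hi<lo a b = subst₂ ℕ._<_ (sym (toℕ-↑ˡ a m)) (sym (toℕ-↑ʳ m b)) (NP.<-≤-trans (toℕ<n a) (NP.m≤m+n m (toℕ b)))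

  hi≢lo : ∀ a b → hi a ≢ lo b
  hi≢lo a b eq = <-irrefl eq (hi<lo a b)

  data Side : Fin n → Set where
    in-hi : ∀ a → Side (hi a)
    in-lo : ∀ b → Side (lo b)

  side : ∀ v → Side v
  side v with splitAt m v in eq
  ... | inj₁ a = subst Side (splitAt⁻¹-↑ˡ eq) (in-hi a)
  ... | inj₂ b = subst Side (splitAt⁻¹-↑ʳ eq) (in-lo b)

  cross : Fin m → Fin m → Edge n
  cross a b = (hi a , lo b) , hi<lo a b

  data EdgeView : Edge n → Set where
    hi-hi : ∀ a b p → EdgeView ((hi a , hi b) , p)
    lo-lo : ∀ a b p → EdgeView ((lo a , lo b) , p)
    hi-lo : ∀ a b → EdgeView (cross a b)

  edgeView : ∀ e → EdgeView e
  edgeView ((u , v) , p) with side u | side v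
  ... | in-hi a | in-hi b = hi-hi a b p
  ... | in-lo a | in-lo b = lo-lo a b p
  ... | in-hi a | in-lo b with refl ← <-irrelevant p (hi<lo a b) = hi-lo a b
  ... | in-lo a | in-hi b = ⊥-elim (<-asym p (hi<lo b a))

  CrossSupported : ZVec n → Set
  CrossSupported f = (∀ a b p → f ((hi a , hi b) , p) ≡ 0ℤ) × (∀ a b p → f ((lo a , lo b) , p) ≡ 0ℤ)

  Σe-cross : (f : ZVec n) → CrossSupported f → Σe f ≡ ∑[ a < m ] ∑[ b < m ] f (cross a b)
  Σe-cross f (f-hh , f-ll) = begin
    Σe f
      ≡⟨ Σe-pairs f ⟩
    ∑[ u < n ] ∑[ v < n ] ΣL (pairIfLess u v) f
      ≡⟨ ∑-splitAt m (λ u → ∑[ v < n ] ΣL (pairIfLess u v) f) ⟩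
    ∑[ a < m ] ∑[ v < n ] ΣL (pairIfLess (hi a) v) f + ∑[ b < m ] ∑[ v < n ] ΣL (pairIfLess (lo b) v) f
      ≡⟨ cong₂ _+_ (sum-cong-≗ (λ a → ∑-splitAt m (λ v → ΣL (pairIfLess (hi a) v) f)))
                    (sum-cong-≗ (λ a → ∑-splitAt m (λ v → ΣL (pairIfLess (lo a) v) f))) ⟩
    ∑[ a < m ] (∑[ b < m ] ΣL (pairIfLess (hi a) (hi b)) f + ∑[ b < m ] ΣL (pairIfLess (hi a) (lo b)) f) +
    ∑[ a < m ] (∑[ b < m ] ΣL (pairIfLess (lo a) (hi b)) f + ∑[ b < m ] ΣL (pairIfLess (lo a) (lo b)) f)
      ≡⟨ cong₂ _+_ (sum-cong-≗ (λ a → cong₂ _+_ (∑≡0 (λ b → ΣL-pairIfLess-0 f (f-hh a b)))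
                                                (sum-cong-≗ (λ b → ΣL-pairIfLess-< (hi<lo a b) f))))
                   (sum-cong-≗ (λ a → cong₂ _+_ (∑≡0 (λ b → ΣL-pairIfLess-0 f (λ lo<hi → ⊥-elim (<-asym lo<hi (hi<lo b a)))))
                                                (∑≡0 (λ b → ΣL-pairIfLess-0 f (f-ll a b))))) ⟩
    ∑[ a < m ] (0ℤ + ∑[ b < m ] f (cross a b)) + ∑[ a < m ] (0ℤ + 0ℤ)
      ≡⟨ cong₂ _+_ (sum-cong-≗ (λ a → ZP.+-identityˡ (∑[ b < m ] f (cross a b)))) (sum-replicate-zero m) ⟩
    ∑[ a < m ] ∑[ b < m ] f (cross a b) + 0ℤ
      ≡⟨ ZP.+-identityʳ _ ⟩
    ∑[ a < m ] ∑[ b < m ] f (cross a b)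
      ∎
    where
    open ≡-Reasoning
    ∑≡0 : {g : Fin m → ℤ} → (∀ b → g b ≡ 0ℤ) → ∑[ b < m ] g b ≡ 0ℤ
    ∑≡0 g≡0 = trans (sum-cong-≗ g≡0) (sum-replicate-zero m)

  row-cross : ∀ r {x : ZVec n} → CrossSupported x →
              row r x ≡ ∑[ a < m ] ∑[ b < m ] (if r (cross a b) then x (cross a b) else 0ℤ)
  row-cross r {x} (x-hh , x-ll) =
    Σe-cross (λ e → if r e then x e else 0ℤ) ((λ a b p → if-0 (r _) (x-hh a b p)) , (λ a b p → if-0 (r _) (x-ll a b p)))
    where
    if-0 : ∀ c {i} → i ≡ 0ℤ → (if c then i else 0ℤ) ≡ 0ℤ
    if-0 true  i≡0 = i≡0
    if-0 false _   = refl

  incident-hi-cross : ∀ c a b → incident (hi c) (cross a b) ≡ does (c ≟ a)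
  incident-hi-cross c a b = begin
    incident (hi c) (cross a b)                   ≡⟨ incident-∨ (hi c) (hi a) (lo b) (hi<lo a b) ⟩
    does (hi c ≟ hi a) ∨ does (hi c ≟ lo b)
      ≡⟨ cong₂ _∨_ (does-≡ (hi c ≟ hi a) (map′ (cong hi) (↑ˡ-injective m c a) (c ≟ a)))
                   (dec-false (hi c ≟ lo b) (hi≢lo c b)) ⟩
    does (c ≟ a) ∨ false                          ≡⟨ Bool.∨-identityʳ _ ⟩
    does (c ≟ a)                                  ∎
    where open ≡-Reasoning

  incident-lo-cross : ∀ d a b → incident (lo d) (cross a b) ≡ does (d ≟ b)
  incident-lo-cross d a b = begin
    incident (lo d) (cross a b)                   ≡⟨ incident-∨ (lo d) (hi a) (lo b) (hi<lo a b) ⟩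
    does (lo d ≟ hi a) ∨ does (lo d ≟ lo b)
      ≡⟨ cong₂ _∨_ (dec-false (lo d ≟ hi a) (hi≢lo a d ∘ sym))
                   (does-≡ (lo d ≟ lo b) (map′ (cong lo) (↑ʳ-injective m d b) (d ≟ b))) ⟩
    does (d ≟ b)                                  ∎
    where open ≡-Reasoning

  cross∈class⇔ : ∀ {i j} → i Fin.≤ j → ∀ a b → inColourClass colour i j (cross a b) ≡ true ⇔ (a , b) ≈ᵘ (i , j)
  cross∈class⇔ {i} {j} i≤j a b = mk⇔
    (subst (_≈ᵘ (i , j)) colours≡ ∘ inColourClass⇒ colour (hi<lo a b))
    (inColourClass⇐ colour i≤j (hi<lo a b) ∘ subst (_≈ᵘ (i , j)) (sym colours≡))
    where
    colours≡ : (colour (hi a) , colour (lo b)) ≡ (a , b)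
    colours≡ = cong₂ _,_ (colour-hi a) (colour-lo b)

  joined : (Fin m → Fin m → Bool) → Fin m ⊎ Fin m → Fin m ⊎ Fin m → Bool
  joined M (inj₁ _) (inj₁ _) = true
  joined M (inj₁ a) (inj₂ b) = M a b
  joined M (inj₂ _) _        = false

  graph : (Fin m → Fin m → Bool) → Graph n
  graph M ((u , v) , _) = joined M (splitAt m u) (splitAt m v)

  graph-hi-hi : ∀ M a b p → graph M ((hi a , hi b) , p) ≡ true
  graph-hi-hi M a b p = cong₂ (joined M) (splitAt-↑ˡ m a m) (splitAt-↑ˡ m b m)

  graph-lo-lo : ∀ M a b p → graph M ((lo a , lo b) , p) ≡ false
  graph-lo-lo M a b p = cong₂ (joined M) (splitAt-↑ʳ m m a) (splitAt-↑ʳ m m b)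

  graph-cross : ∀ M a b → graph M (cross a b) ≡ M a b
  graph-cross M a b = cong₂ (joined M) (splitAt-↑ˡ m a m) (splitAt-↑ʳ m m b)

  ⊖-cross-supported : ∀ M M′ → CrossSupported (graph M ⊖ graph M′)
  ⊖-cross-supported M M′ =
    (λ a b p → cong₂ (λ c d → b2z c - b2z d) (graph-hi-hi M a b p) (graph-hi-hi M′ a b p)) ,
    (λ a b p → cong₂ (λ c d → b2z c - b2z d) (graph-lo-lo M a b p) (graph-lo-lo M′ a b p))

  γ γ′ : Graph n
  γ  = graph (λ a b → does (b ≟ rotate a))
  γ′ = graph (λ a b → does (rotate b ≟ a))

  δ′-cross : ∀ a b → (γ′ ⊖ γ) (cross a b) ≡ b2z (does (rotate b ≟ a)) - b2z (does (b ≟ rotate a))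
  δ′-cross a b = cong₂ (λ c d → b2z c - b2z d) (graph-cross _ a b) (graph-cross _ a b)

  γ′-degrees : ∀ w → Dx (γ′ ⊖ γ) w ≡ 0ℤ
  γ′-degrees w with side w
  ... | in-hi c = begin
    Dx (γ′ ⊖ γ) (hi c)
      ≡⟨ row-cross (incident (hi c)) (⊖-cross-supported _ _) ⟩
    ∑[ a < m ] ∑[ b < m ] (if incident (hi c) (cross a b) then (γ′ ⊖ γ) (cross a b) else 0ℤ)
      ≡⟨ sum-cong-≗ (λ a → trans (sum-cong-≗ (λ b → cong (λ t → if t then (γ′ ⊖ γ) (cross a b) else 0ℤ)
                                                          (incident-hi-cross c a b)))
                                 (∑-if (does (c ≟ a)) (λ b → (γ′ ⊖ γ) (cross a b)))) ⟩
    ∑[ a < m ] (if does (c ≟ a) then ∑[ b < m ] (γ′ ⊖ γ) (cross a b) else 0ℤ)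
      ≡⟨ ∑-selectˡ c (λ a → ∑[ b < m ] (γ′ ⊖ γ) (cross a b)) ⟩
    ∑[ b < m ] (γ′ ⊖ γ) (cross c b)
      ≡⟨ trans (sum-cong-≗ (δ′-cross c))
               (∑-distrib-− (λ b → b2z (does (rotate b ≟ c))) (λ b → b2z (does (b ≟ rotate c)))) ⟩
    ∑[ b < m ] b2z (does (rotate b ≟ c)) - ∑[ b < m ] b2z (does (b ≟ rotate c))
      ≡⟨ cong₂ _-_ (trans (∑-rotate (λ b → b2z (does (b ≟ c)))) (∑-indicatorʳ c)) (∑-indicatorʳ (rotate c)) ⟩
    + 1 - + 1
      ∎
    where open ≡-Reasoning
  ... | in-lo d = begin
    Dx (γ′ ⊖ γ) (lo d)
      ≡⟨ row-cross (incident (lo d)) (⊖-cross-supported _ _) ⟩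
    ∑[ a < m ] ∑[ b < m ] (if incident (lo d) (cross a b) then (γ′ ⊖ γ) (cross a b) else 0ℤ)
      ≡⟨ sum-cong-≗ (λ a → trans (sum-cong-≗ (λ b → cong (λ t → if t then (γ′ ⊖ γ) (cross a b) else 0ℤ)
                                                          (incident-lo-cross d a b)))
                                 (∑-selectˡ d (λ b → (γ′ ⊖ γ) (cross a b)))) ⟩
    ∑[ a < m ] (γ′ ⊖ γ) (cross a d)
      ≡⟨ trans (sum-cong-≗ (λ a → δ′-cross a d))
               (∑-distrib-− (λ a → b2z (does (rotate d ≟ a))) (λ a → b2z (does (d ≟ rotate a)))) ⟩
    ∑[ a < m ] b2z (does (rotate d ≟ a)) - ∑[ a < m ] b2z (does (d ≟ rotate a))
      ≡⟨ cong₂ _-_ (∑-indicatorˡ (rotate d)) (trans (∑-rotate (λ a → b2z (does (d ≟ a)))) (∑-indicatorˡ d)) ⟩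
    + 1 - + 1
      ∎
    where open ≡-Reasoning

  inColourClass-cross-sym : ∀ {i j} → i Fin.≤ j → ∀ a b →
                            inColourClass colour i j (cross a b) ≡ inColourClass colour i j (cross b a)
  inColourClass-cross-sym i≤j a b =
    Bool.⇔→≡ (⇔.trans (cross∈class⇔ i≤j a b) (⇔.trans (mk⇔ ≈ᵘ-swap ≈ᵘ-swap) (⇔.sym (cross∈class⇔ i≤j b a))))

  if-δ′-cross : ∀ c a b → (if c then (γ′ ⊖ γ) (cross a b) else 0ℤ) ≡
                          (if does (rotate b ≟ a) then b2z c else 0ℤ) - (if does (b ≟ rotate a) then b2z c else 0ℤ)
  if-δ′-cross c a b = begin
    (if c then (γ′ ⊖ γ) (cross a b) else 0ℤ)
      ≡⟨ cong (λ t → if c then t else 0ℤ) (δ′-cross a b) ⟩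
    (if c then b2z (does (rotate b ≟ a)) - b2z (does (b ≟ rotate a)) else 0ℤ)
      ≡⟨ if-− c _ _ ⟩
    (if c then b2z (does (rotate b ≟ a)) else 0ℤ) - (if c then b2z (does (b ≟ rotate a)) else 0ℤ)
      ≡⟨ cong₂ _-_ (if-b2z-comm c _) (if-b2z-comm c _) ⟩
    (if does (rotate b ≟ a) then b2z c else 0ℤ) - (if does (b ≟ rotate a) then b2z c else 0ℤ)
      ∎
    where open ≡-Reasoning

  γ′-colour-counts : ∀ i j → i Fin.≤ j → Cx colour (γ′ ⊖ γ) i j ≡ 0ℤ
  γ′-colour-counts i j i≤j = begin
    Cx colour (γ′ ⊖ γ) i j
      ≡⟨ row-cross (inColourClass colour i j) (⊖-cross-supported _ _) ⟩
    ∑[ a < m ] ∑[ b < m ] (if inClass a b then (γ′ ⊖ γ) (cross a b) else 0ℤ)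
      ≡⟨ sum-cong-≗ (λ a → trans (sum-cong-≗ (λ b → if-δ′-cross (inClass a b) a b))
                                 (∑-distrib-− (match′ a) (match a))) ⟩
    ∑[ a < m ] (∑[ b < m ] match′ a b - ∑[ b < m ] match a b)
      ≡⟨ ∑-distrib-− (λ a → ∑[ b < m ] match′ a b) (λ a → ∑[ b < m ] match a b) ⟩
    ∑[ a < m ] ∑[ b < m ] match′ a b - ∑[ a < m ] ∑[ b < m ] match a b
      ≡⟨ cong₂ _-_ (trans (∑-comm match′) (sum-cong-≗ (λ b → trans (∑-selectˡ (rotate b) (λ a → b2z (inClass a b)))
                                                                      (cong b2z (inColourClass-cross-sym i≤j (rotate b) b)))))
                   (sum-cong-≗ (λ a → ∑-selectʳ (rotate a) (λ b → b2z (inClass a b)))) ⟩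
    ∑[ a < m ] b2z (inClass a (rotate a)) - ∑[ a < m ] b2z (inClass a (rotate a))
      ≡⟨ ZP.+-inverseʳ (∑[ a < m ] b2z (inClass a (rotate a))) ⟩
    0ℤ
      ∎
    where
    open ≡-Reasoning
    inClass : Fin m → Fin m → Bool
    inClass a b = inColourClass colour i j (cross a b)
    match match′ : Fin m → Fin m → ℤ
    match  a b = if does (b ≟ rotate a) then b2z (inClass a b) else 0ℤ
    match′ a b = if does (rotate b ≟ a) then b2z (inClass a b) else 0ℤ

  γ′∈fibre : SameImage colour (asZ γ′) (asZ γ)
  γ′∈fibre = InKernel⇒SameImage colour (γ′-degrees , γ′-colour-counts)

  γ′≢γ-at : ∀ a → γ′ (cross a (rotate a)) ≢ γ (cross a (rotate a))
  γ′≢γ-at a eq = rotate²≢id a (does≡true⇒ (rotate (rotate a) ≟ a) (begin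
    does (rotate (rotate a) ≟ a)     ≡⟨ graph-cross _ a (rotate a) ⟨
    γ′ (cross a (rotate a))          ≡⟨ eq ⟩
    γ (cross a (rotate a))           ≡⟨ graph-cross _ a (rotate a) ⟩
    does (rotate a ≟ rotate a)       ≡⟨ dec-true (rotate a ≟ rotate a) refl ⟩
    true                             ∎))
    where open ≡-Reasoning

  γ′≉γ : ¬ γ′ ≗ γ
  γ′≉γ γ′≗γ = γ′≢γ-at zero (γ′≗γ (cross zero (rotate zero)))

  module Rigidity (γ₁ : Graph n) (fibre : SameImage colour (asZ γ₁) (asZ γ)) where

    δ : ZVec n
    δ = γ₁ ⊖ γ

    degrees≡0 : ∀ w → Dx δ w ≡ 0ℤ
    degrees≡0 = proj₁ (SameImage⇒InKernel colour fibre)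

    colour-counts≡0 : ∀ i j → i Fin.≤ j → Cx colour δ i j ≡ 0ℤ
    colour-counts≡0 = proj₂ (SameImage⇒InKernel colour fibre)

    δ-at : ∀ e {c} → γ e ≡ c → δ e ≡ b2z (γ₁ e) - b2z c
    δ-at e = cong (λ c → b2z (γ₁ e) - b2z c)

    sign : Fin n → ℤ
    sign = [ (λ _ → -1ℤ) , (λ _ → 1ℤ) ]′ ∘ splitAt m

    sign-hi : ∀ a → sign (hi a) ≡ -1ℤ
    sign-hi a = cong [ (λ _ → -1ℤ) , (λ _ → 1ℤ) ]′ (splitAt-↑ˡ m a m)

    sign-lo : ∀ b → sign (lo b) ≡ 1ℤ
    sign-lo b = cong [ (λ _ → -1ℤ) , (λ _ → 1ℤ) ]′ (splitAt-↑ʳ m m b)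

    weighted-hi-hi : ∀ a b p → weight sign ((hi a , hi b) , p) * δ ((hi a , hi b) , p) ≡
                               (-1ℤ + -1ℤ) * (b2z (γ₁ ((hi a , hi b) , p)) - 1ℤ)
    weighted-hi-hi a b p = cong₂ _*_ (cong₂ _+_ (sign-hi a) (sign-hi b)) (δ-at ((hi a , hi b) , p) (graph-hi-hi _ a b p))

    weighted-lo-lo : ∀ a b p → weight sign ((lo a , lo b) , p) * δ ((lo a , lo b) , p) ≡
                               (1ℤ + 1ℤ) * (b2z (γ₁ ((lo a , lo b) , p)) - 0ℤ)
    weighted-lo-lo a b p = cong₂ _*_ (cong₂ _+_ (sign-lo a) (sign-lo b)) (δ-at ((lo a , lo b) , p) (graph-lo-lo _ a b p))

    weighted-terms≥0 : ∀ e → 0ℤ ≤ℤ weight sign e * δ e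
    weighted-terms≥0 e with edgeView e
    ... | hi-hi a b p = subst (0ℤ ≤ℤ_) (sym (weighted-hi-hi a b p)) (hi-hi≥0 (γ₁ _))
      where
      hi-hi≥0 : ∀ c → 0ℤ ≤ℤ (-1ℤ + -1ℤ) * (b2z c - 1ℤ)
      hi-hi≥0 true  = +≤+ z≤n
      hi-hi≥0 false = +≤+ z≤n
    ... | lo-lo a b p = subst (0ℤ ≤ℤ_) (sym (weighted-lo-lo a b p)) (lo-lo≥0 (γ₁ _))
      where
      lo-lo≥0 : ∀ c → 0ℤ ≤ℤ (1ℤ + 1ℤ) * (b2z c - 0ℤ)
      lo-lo≥0 true  = +≤+ z≤n
      lo-lo≥0 false = +≤+ z≤n
    ... | hi-lo a b =
      ZP.≤-reflexive (sym (trans (cong (_* δ (cross a b)) (cong₂ _+_ (sign-hi a) (sign-lo b))) (ZP.*-zeroˡ (δ (cross a b)))))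

    weighted-term≡0 : ∀ e → weight sign e * δ e ≡ 0ℤ
    weighted-term≡0 e = ΣL≡0⇒nonneg-terms≡0 (edges n) weighted-terms≥0 weighted-sum≡0 (∈-edges e)
      where
      weighted-sum≡0 : Σe (λ e → weight sign e * δ e) ≡ 0ℤ
      weighted-sum≡0 = begin
        Σe (λ e → weight sign e * δ e)  ≡⟨ ∑-weighted-degree sign δ ⟨
        ∑[ w < n ] (sign w * Dx δ w)     ≡⟨ sum-cong-≗ (λ w → trans (cong (sign w *_) (degrees≡0 w)) (ZP.*-zeroʳ (sign w))) ⟩
        ∑[ w < n ] 0ℤ                    ≡⟨ sum-replicate-zero n ⟩
        0ℤ                               ∎
        where open ≡-Reasoning

    δ-hi-hi≡0 : ∀ a b p → δ ((hi a , hi b) , p) ≡ 0ℤ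
    δ-hi-hi≡0 a b p = trans (δ-at e (graph-hi-hi _ a b p)) (cancel (γ₁ e) (trans (sym (weighted-hi-hi a b p)) (weighted-term≡0 e)))
      where
      e = (hi a , hi b) , p
      cancel : ∀ c → (-1ℤ + -1ℤ) * (b2z c - 1ℤ) ≡ 0ℤ → b2z c - 1ℤ ≡ 0ℤ
      cancel true  _ = refl
      cancel false ()

    δ-lo-lo≡0 : ∀ a b p → δ ((lo a , lo b) , p) ≡ 0ℤ
    δ-lo-lo≡0 a b p = trans (δ-at e (graph-lo-lo _ a b p)) (cancel (γ₁ e) (trans (sym (weighted-lo-lo a b p)) (weighted-term≡0 e)))
      where
      e = (lo a , lo b) , p
      cancel : ∀ c → (1ℤ + 1ℤ) * (b2z c - 0ℤ) ≡ 0ℤ → b2z c - 0ℤ ≡ 0ℤ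
      cancel true  ()
      cancel false _ = refl

    Δ : Fin m → Fin m → ℤ
    Δ a b = δ (cross a b)

    Δ-at : ∀ a b {c} → does (b ≟ rotate a) ≡ c → Δ a b ≡ b2z (γ₁ (cross a b)) - b2z c
    Δ-at a b eq = δ-at (cross a b) (trans (graph-cross _ a b) eq)

    Δ-nonneg : ∀ {a b} → b ≢ rotate a → 0ℤ ≤ℤ Δ a b
    Δ-nonneg {a} {b} b≢ = subst (0ℤ ≤ℤ_) (sym (Δ-at a b (dec-false (b ≟ rotate a) b≢))) (nonneg (γ₁ (cross a b)))
      where
      nonneg : ∀ c → 0ℤ ≤ℤ b2z c - 0ℤ
      nonneg true  = +≤+ z≤n
      nonneg false = +≤+ z≤n

    Δ-nonpos : ∀ a → Δ a (rotate a) ≤ℤ 0ℤ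
    Δ-nonpos a = subst (_≤ℤ 0ℤ) (sym (Δ-at a (rotate a) (dec-true (rotate a ≟ rotate a) refl))) (nonpos (γ₁ (cross a (rotate a))))
      where
      nonpos : ∀ c → b2z c - 1ℤ ≤ℤ 0ℤ
      nonpos true  = +≤+ z≤n
      nonpos false = -≤+

    module SignPattern (R : ℤ → Set) (R0 : R 0ℤ)
      (row-R≡0 : ∀ r (x : ZVec n) → (∀ e → r e ≡ true → R (x e)) → row r x ≡ 0ℤ →
                 ∀ e → r e ≡ true → x e ≡ 0ℤ) where

      cross-row≡0 : ∀ r → row r δ ≡ 0ℤ → (∀ a b → r (cross a b) ≡ true → R (Δ a b)) →
                    ∀ a b → r (cross a b) ≡ true → Δ a b ≡ 0ℤ
      cross-row≡0 r row≡0 RΔ a b = row-R≡0 r δ Rδ row≡0 (cross a b)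
        where
        Rδ : ∀ e → r e ≡ true → R (δ e)
        Rδ e with edgeView e
        ... | hi-hi a b p = λ _ → subst R (sym (δ-hi-hi≡0 a b p)) R0
        ... | lo-lo a b p = λ _ → subst R (sym (δ-lo-lo≡0 a b p)) R0
        ... | hi-lo a b   = RΔ a b

      colour-class≡0 : ∀ a b → R (Δ a b) → R (Δ b a) → Δ a b ≡ 0ℤ
      colour-class≡0 a b RΔab RΔba with sortPair a b
      ... | i , j , i≤j , ab≈ij =
        cross-row≡0 (inColourClass colour i j) (colour-counts≡0 i j i≤j) RΔ a b (Equivalence.from (cross∈class⇔ i≤j a b) ab≈ij)
        where
        R-pair : ∀ {a′ b′} → (a′ , b′) ≈ᵘ (a , b) → R (Δ a′ b′)
        R-pair (inj₁ (refl , refl)) = RΔab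
        R-pair (inj₂ (refl , refl)) = RΔba
        RΔ : ∀ a′ b′ → inColourClass colour i j (cross a′ b′) ≡ true → R (Δ a′ b′)
        RΔ a′ b′ in-class = R-pair (≈ᵘ-trans (Equivalence.to (cross∈class⇔ i≤j a′ b′) in-class) (≈ᵘ-sym ab≈ij))

      vertex≡0 : ∀ c → (∀ b → R (Δ c b)) → ∀ b → Δ c b ≡ 0ℤ
      vertex≡0 c RΔc b =
        cross-row≡0 (incident (hi c)) (degrees≡0 (hi c)) RΔ c b (trans (incident-hi-cross c c b) (dec-true (c ≟ c) refl))
        where
        RΔ : ∀ a b → incident (hi c) (cross a b) ≡ true → R (Δ a b)
        RΔ a b incident≡true with refl ← does≡true⇒ (c ≟ a) (trans (sym (incident-hi-cross c a b)) incident≡true) = RΔc b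

    open SignPattern (0ℤ ≤ℤ_) ZP.≤-refl row≡0⇒nonneg-entries≡0
      renaming (colour-class≡0 to colour-class-nonneg≡0; vertex≡0 to vertex-nonneg≡0)
    open SignPattern (_≤ℤ 0ℤ) ZP.≤-refl row≡0⇒nonpos-entries≡0
      renaming (colour-class≡0 to colour-class-nonpos≡0; vertex≡0 to vertex-nonpos≡0)

    Δ-off-matchings≡0 : ∀ {a b} → b ≢ rotate a → a ≢ rotate b → Δ a b ≡ 0ℤ
    Δ-off-matchings≡0 b≢ a≢ = colour-class-nonneg≡0 _ _ (Δ-nonneg b≢) (Δ-nonneg a≢)

    Kept : Fin m → Set
    Kept a = Δ a (rotate a) ≡ 0ℤ

    Kept⇔reverse≡0 : ∀ a → Kept a ⇔ Δ (rotate a) a ≡ 0ℤ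
    Kept⇔reverse≡0 a = mk⇔
      (λ kept → colour-class-nonneg≡0 (rotate a) a (Δ-nonneg (rotate²≢id a ∘ sym)) (ZP.≤-reflexive (sym kept)))
      (λ reverse≡0 → colour-class-nonpos≡0 a (rotate a) (Δ-nonpos a) (ZP.≤-reflexive reverse≡0))

    Kept-rotate⇔reverse≡0 : ∀ a → Kept (rotate a) ⇔ Δ (rotate a) a ≡ 0ℤ
    Kept-rotate⇔reverse≡0 a = mk⇔
      (λ kept → vertex-nonneg≡0 (rotate a) (nonneg kept) a)
      (λ reverse≡0 → vertex-nonpos≡0 (rotate a) (nonpos reverse≡0) (rotate (rotate a)))
      where
      -- In the row of hi (rotate a) only the entries at rotate (rotate a) (≤ 0) and at a (≥ 0) can be nonzero.
      nonneg : Kept (rotate a) → ∀ b → 0ℤ ≤ℤ Δ (rotate a) b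
      nonneg kept b with b ≟ rotate (rotate a)
      ... | yes refl = ZP.≤-reflexive (sym kept)
      ... | no b≢    = Δ-nonneg b≢
      nonpos : Δ (rotate a) a ≡ 0ℤ → ∀ b → Δ (rotate a) b ≤ℤ 0ℤ
      nonpos reverse≡0 b with b ≟ rotate (rotate a) | b ≟ a
      ... | yes refl | _        = Δ-nonpos (rotate a)
      ... | no _     | yes refl = ZP.≤-reflexive reverse≡0
      ... | no b≢    | no b≢a   = ZP.≤-reflexive (Δ-off-matchings≡0 b≢ (b≢a ∘ rotate-injective ∘ sym))

    Kept-constant : ∀ a b → Kept a → Kept b
    Kept-constant = rotate-invariant⇒constant Kept (λ a → ⇔.trans (Kept⇔reverse≡0 a) (⇔.sym (Kept-rotate⇔reverse≡0 a)))

    all-kept⇒δ≡0 : (∀ a → Kept a) → ∀ e → δ e ≡ 0ℤ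
    all-kept⇒δ≡0 kept e with edgeView e
    ... | hi-hi a b p = δ-hi-hi≡0 a b p
    ... | lo-lo a b p = δ-lo-lo≡0 a b p
    ... | hi-lo a b with b ≟ rotate a | a ≟ rotate b
    ...   | yes refl | _        = kept a
    ...   | no _     | yes refl = Equivalence.to (Kept⇔reverse≡0 b) (kept b)
    ...   | no b≢    | no a≢    = Δ-off-matchings≡0 b≢ a≢

    all-kept⇒γ₁≗γ : (∀ a → Kept a) → γ₁ ≗ γ
    all-kept⇒γ₁≗γ kept e = b2z-injective (ZP.i-j≡0⇒i≡j _ _ (all-kept⇒δ≡0 kept e))

    none-kept⇒far : (∀ a → ¬ Kept a) → m ≤ norm1 δ
    none-kept⇒far not-kept = ZP.drop‿+≤+ (begin
      (+ m)                                ≡⟨ ∑-one m ⟨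
      ∑[ a < m ] (+ 1)                     ≤⟨ ∑-mono-≤ (λ a → +≤+ (NP.n≢0⇒n>0 (not-kept a ∘ ZP.∣i∣≡0⇒i≡0))) ⟩
      ∑[ a < m ] (+ ∣ Δ a (rotate a) ∣)    ≤⟨ ∑-mono-≤ (λ a → term≤∑ {f = λ b → + ∣ Δ a b ∣} (λ b → +≤+ z≤n) (rotate a)) ⟩
      ∑[ a < m ] ∑[ b < m ] (+ ∣ Δ a b ∣)  ≡⟨ Σe-cross (λ e → + ∣ δ e ∣) ∣δ∣-cross-supported ⟨
      Σe (λ e → + ∣ δ e ∣)                 ≡⟨ norm1-as-Σe δ ⟨
      (+ norm1 δ)                          ∎)
      where
      open ZP.≤-Reasoning
      ∣δ∣-cross-supported : CrossSupported (λ e → + ∣ δ e ∣)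
      ∣δ∣-cross-supported = (λ a b p → cong (λ i → + ∣ i ∣) (δ-hi-hi≡0 a b p)) ,
                            (λ a b p → cong (λ i → + ∣ i ∣) (δ-lo-lo≡0 a b p))

    far-from-γ : ¬ γ₁ ≗ γ → m ≤ norm1 δ
    far-from-γ γ₁≉γ with Δ zero (rotate zero) ZP.≟ 0ℤ
    ... | yes kept₀ = ⊥-elim (γ₁≉γ (all-kept⇒γ₁≗γ (λ a → Kept-constant zero a kept₀)))
    ... | no ¬kept₀ = none-kept⇒far (λ a kept → ¬kept₀ (Kept-constant a zero kept))

theorem1p2 : (C : ℕ) → Σ[ n ∈ ℕ ] Σ[ k ∈ ℕ ] (1 ≤ n) × (1 ≤ k) ×
    Σ[ z ∈ (Fin n → Fin k) ] ((B : VSet n) → IsSimpleMarkovBasis z B →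
      ∃[ γ ] B γ × C < norm1 γ)
theorem1p2 C = n , m , ℕ.s≤s z≤n , ℕ.s≤s z≤n , colour , long-move
  where
  open Construction C
  long-move : (B : VSet n) → IsSimpleMarkovBasis colour B → ∃[ b ] B b × C < norm1 b
  long-move B basis =
    map₂ (map₂ (NP.<-≤-trans C<m)) (far-fibre-point⇒long-move {B = B} Rigidity.far-from-γ basis γ′ γ′∈fibre γ′≉γ)
    where
    C<m : C < m
    C<m = NP.m≤n+m (ℕ.suc C) 2
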